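{- Let $A$ be a pseudo-hoop and $\mu$ a compatible type II state operator on $A$, with kernel $K={\rm Ker}(\mu)=\{x\in A\mid\mu(x)=1\}$. Then: (1) the map $\hat\mu:A/K\to A/K$, $\hat\mu(x/K)=\mu(x)/K$, is well defined and is both a compatible type I and a compatible type II state operator on $A/K$; (2) $\mu$ is a compatible type I state operator on $A$.
   Context: A pseudo-hoop is an algebra $(A,\odot,\rightarrow,\rightsquigarrow,1)$ of type $(2,2,2,0)$ such that for all $x,y,z\in A$: $x\odot 1=1\odot x=x$; $x\rightarrow x=x\rightsquigarrow x=1$; $(x\odot y)\rightarrow z=x\rightarrow(y\rightarrow z)$; $(x\odot y)\rightsquigarrow z=y\rightsquigarrow(x\rightsquigarrow z)$; $(x\rightarrow y)\odot x=(y\rightarrow x)\odot y=x\odot(x\rightsquigarrow y)=y\odot(y\rightsquigarrow x)$. The order is $x\le y$ iff $x\rightarrow y=1$. Put $x\vee_1 y=(x\rightarrow y)\rightsquigarrow y$, $x\vee_2 y=(x\rightsquigarrow y)\rightarrow y$. For $\mu:A\to A$ and all $x,y$ consider: (IS1) $\mu(x\rightarrow y)=\mu(x\vee_1 y)\rightarrow\mu(y)$ and $\mu(x\rightsquigarrow y)=\mu(x\vee_2 y)\rightsquigarrow\mu(y)$; (IS1') $\mu(x\rightarrow y)=\mu(y\vee_1 x)\rightarrow\mu(y)$ and $\mu(x\rightsquigarrow y)=\mu(y\vee_2 x)\rightsquigarrow\mu(y)$; (IS2) $\mu(x\odot y)=\mu(x)\odot\mu(x\rightsquigarrow x\odot y)=\mu(y\rightarrow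 x\odot y)\odot\mu(y)$; (IS3) $\mu(\mu(x)\odot\mu(y))=\mu(x)\odot\mu(y)$; (IS4) $\mu(\mu(x)\rightarrow\mu(y))=\mu(x)\rightarrow\mu(y)$ and $\mu(\mu(x)\rightsquigarrow\mu(y))=\mu(x)\rightsquigarrow\mu(y)$. Type I: (IS1),(IS2),(IS3),(IS4); type II: (IS1'),(IS2),(IS3),(IS4). A filter is a nonempty $F\subseteq A$ closed under $\odot$ and upward closed; it is normal if for all $x,y$: $x\rightarrow y\in F$ iff $x\rightsquigarrow y\in F$. A state operator is compatible if its kernel ${\rm Ker}(\mu)$ is a normal filter. For a normal filter $F$, $(x,y)\in\Theta_F$ iff $x\rightarrow y\in F$ and $y\rightarrow x\in F$ defines a congruence; $A/F$ is the quotient pseudo-hoop and $x/F$ the class of $x$. -}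

module Defs where

open import Data.Product using (Σ; ∃; _×_; _,_)
open import Relation.Binary.PropositionalEquality using (_≡_)

record PseudoHoop : Set₁ where
  infixl 7 _⊙_
  infixr 5 _⇒_ _⇝_
  field
    Carrier : Set
    _⊙_ _⇒_ _⇝_ : Carrier → Carrier → Carrier
    one : Carrier
    ⊙-identityʳ : ∀ x → x ⊙ one ≡ x
    ⊙-identityˡ : ∀ x → one ⊙ x ≡ x
    ⇒-refl : ∀ x → x ⇒ x ≡ one
    ⇝-refl : ∀ x → x ⇝ x ≡ one
    ⊙-⇒ : ∀ x y z → (x ⊙ y) ⇒ z ≡ x ⇒ (y ⇒ z)
    ⊙-⇝ : ∀ x y z → (x ⊙ y) ⇝ z ≡ y ⇝ (x ⇝ z)
    div₁ : ∀ x y → (x ⇒ y) ⊙ x ≡ (y ⇒ x) ⊙ y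
    div₂ : ∀ x y → (y ⇒ x) ⊙ y ≡ x ⊙ (x ⇝ y)
    div₃ : ∀ x y → x ⊙ (x ⇝ y) ≡ y ⊙ (y ⇝ x)

-- All notions below are parametrised by an equivalence _≈_ on the carrier,
-- so that they apply both to A itself (_≈_ = _≡_) and to a quotient A/F,
-- represented (no quotient types in Agda) as the carrier of A with the
-- congruence Θ_F as equality.  Subsets of A/F are predicates on A that
-- respect _≈_; maps A/F → A/F are maps A → A respecting _≈_.
module _ (A : PseudoHoop) where
  open PseudoHoop A

  _∨₁_ _∨₂_ : Carrier → Carrier → Carrier
  x ∨₁ y = (x ⇒ y) ⇝ y
  x ∨₂ y = (x ⇝ y) ⇒ y

  module Over (_≈_ : Carrier → Carrier → Set) where

    _≤_ : Carrier → Carrier → Set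
    x ≤ y = (x ⇒ y) ≈ one

    RespectsPred : (Carrier → Set) → Set
    RespectsPred F = ∀ x y → x ≈ y → F x → F y

    RespectsMap : (Carrier → Carrier) → Set
    RespectsMap f = ∀ x y → x ≈ y → f x ≈ f y

    record IsFilter (F : Carrier → Set) : Set where
      field
        respects  : RespectsPred F
        nonempty  : ∃ λ x → F x
        ⊙-closed  : ∀ x y → F x → F y → F (x ⊙ y)
        up-closed : ∀ x y → F x → x ≤ y → F y

    record IsNormalFilter (F : Carrier → Set) : Set where
      field
        isFilter : IsFilter F
        normal₁  : ∀ x y → F (x ⇒ y) → F (x ⇝ y)
        normal₂  : ∀ x y → F (x ⇝ y) → F (x ⇒ y)

    Ker : (Carrier → Carrier) → Carrier → Set
    Ker μ x = μ x ≈ one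

    IS1 IS1' IS2 IS3 IS4 : (Carrier → Carrier) → Set
    IS1 μ = ∀ x y → (μ (x ⇒ y) ≈ (μ (x ∨₁ y) ⇒ μ y))
                  × (μ (x ⇝ y) ≈ (μ (x ∨₂ y) ⇝ μ y))
    IS1' μ = ∀ x y → (μ (x ⇒ y) ≈ (μ (y ∨₁ x) ⇒ μ y))
                   × (μ (x ⇝ y) ≈ (μ (y ∨₂ x) ⇝ μ y))
    IS2 μ = ∀ x y → (μ (x ⊙ y) ≈ (μ x ⊙ μ (x ⇝ (x ⊙ y))))
                  × (μ (x ⊙ y) ≈ (μ (y ⇒ (x ⊙ y)) ⊙ μ y))
    IS3 μ = ∀ x y → μ (μ x ⊙ μ y) ≈ (μ x ⊙ μ y)
    IS4 μ = ∀ x y → (μ (μ x ⇒ μ y) ≈ (μ x ⇒ μ y))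
                  × (μ (μ x ⇝ μ y) ≈ (μ x ⇝ μ y))

    TypeI TypeII : (Carrier → Carrier) → Set
    TypeI μ = IS1 μ × IS2 μ × IS3 μ × IS4 μ
    TypeII μ = IS1' μ × IS2 μ × IS3 μ × IS4 μ

    Compatible : (Carrier → Carrier) → Set
    Compatible μ = IsNormalFilter (Ker μ)

    CompatibleTypeI CompatibleTypeII : (Carrier → Carrier) → Set
    CompatibleTypeI μ = TypeI μ × Compatible μ
    CompatibleTypeII μ = TypeII μ × Compatible μ

  module OnA = Over _≡_

  Θ : (Carrier → Set) → Carrier → Carrier → Set
  Θ F x y = F (x ⇒ y) × F (y ⇒ x)

  module OnQuot (F : Carrier → Set) = Over (Θ F)

-- (x ∨₁ y) → y = x → y and y ∨₁ (x ∨₁ y) = x ∨₁ y hold in every pseudo-hoop,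
-- so instantiating (IS1') at the pair (x ∨₁ y, y) yields (IS1) at (x, y),
-- and dually for ⇝ and ∨₂: a type II state operator is of type I.
-- For a type I operator, μ(x → y) = 1 forces μ(x) ≤ μ(y), which together
-- with (IS4) makes μ respect Θ_K; since μ(1) = 1 and μ is idempotent, the
-- kernel of μ̂ is K itself, so it is a normal filter of A/K.  Finally every
-- identity (IS1)–(IS4) passes from A to A/K because equality is contained in Θ_K.
module Submission where

open import Defs
open import Data.Product using (_×_; _,_; proj₁; proj₂)
open import Relation.Binary.PropositionalEquality
  using (_≡_; refl; sym; trans; cong; subst; module ≡-Reasoning)

-- In the dual, ∨₁ is the ∨₂ of A, so each ⇒/∨₁ lemma also gives its ⇝/∨₂ mirror.
dual : PseudoHoop → PseudoHoop
dual A = record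
  { Carrier     = Carrier
  ; _⊙_         = λ x y → y ⊙ x
  ; _⇒_         = _⇝_
  ; _⇝_         = _⇒_
  ; one         = one
  ; ⊙-identityʳ = ⊙-identityˡ
  ; ⊙-identityˡ = ⊙-identityʳ
  ; ⇒-refl      = ⇝-refl
  ; ⇝-refl      = ⇒-refl
  ; ⊙-⇒         = λ x y z → ⊙-⇝ y x z
  ; ⊙-⇝         = λ x y z → ⊙-⇒ y x z
  ; div₁        = div₃
  ; div₂        = λ x y → sym (trans (div₁ x y) (trans (div₂ x y) (div₃ x y)))
  ; div₃        = div₁
  }
  where open PseudoHoop A

module PseudoHoopProperties (A : PseudoHoop) where
  open PseudoHoop A
  open OnA A using (_≤_)
  open ≡-Reasoning

  ≤-refl : ∀ x → x ≤ x
  ≤-refl = ⇒-refl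

  ≤-antisym : ∀ {x y} → x ≤ y → y ≤ x → x ≡ y
  ≤-antisym {x} {y} x≤y y≤x = begin
    x             ≡⟨ sym (⊙-identityˡ x) ⟩
    one ⊙ x       ≡⟨ cong (_⊙ x) (sym x≤y) ⟩
    (x ⇒ y) ⊙ x   ≡⟨ div₁ x y ⟩
    (y ⇒ x) ⊙ y   ≡⟨ cong (_⊙ y) y≤x ⟩
    one ⊙ y       ≡⟨ ⊙-identityˡ y ⟩
    y             ∎

  ≤→⊙-meet : ∀ {x y} → x ≤ y → (y ⇒ x) ⊙ y ≡ x
  ≤→⊙-meet {x} {y} x≤y =
    trans (sym (div₁ x y)) (trans (cong (_⊙ x) x≤y) (⊙-identityˡ x))

  ⊙≤→≤⇒ : ∀ {x y z} → (x ⊙ y) ≤ z → x ≤ (y ⇒ z)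
  ⊙≤→≤⇒ {x} {y} {z} = trans (sym (⊙-⇒ x y z))

  ≤⇒→⊙≤ : ∀ {x y z} → x ≤ (y ⇒ z) → (x ⊙ y) ≤ z
  ≤⇒→⊙≤ {x} {y} {z} = trans (⊙-⇒ x y z)

  ≤→⇝≡1 : ∀ {x y} → x ≤ y → x ⇝ y ≡ one
  ≤→⇝≡1 {x} {y} x≤y = begin
    x ⇝ y               ≡⟨ cong (_⇝ y) (sym x⊙[x⇝y]≡x) ⟩
    (x ⊙ (x ⇝ y)) ⇝ y   ≡⟨ ⊙-⇝ x (x ⇝ y) y ⟩
    (x ⇝ y) ⇝ (x ⇝ y)   ≡⟨ ⇝-refl _ ⟩
    one                 ∎
    where
    x⊙[x⇝y]≡x : x ⊙ (x ⇝ y) ≡ x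
    x⊙[x⇝y]≡x = trans (sym (div₂ x y)) (≤→⊙-meet x≤y)

  ⇝≡1→≤ : ∀ {x y} → x ⇝ y ≡ one → x ≤ y
  ⇝≡1→≤ {x} {y} x⇝y≡1 = begin
    x ⇒ y               ≡⟨ cong (_⇒ y) (sym [x⇒y]⊙x≡x) ⟩
    ((x ⇒ y) ⊙ x) ⇒ y   ≡⟨ ⊙-⇒ (x ⇒ y) x y ⟩
    (x ⇒ y) ⇒ (x ⇒ y)   ≡⟨ ⇒-refl _ ⟩
    one                 ∎
    where
    [x⇒y]⊙x≡x : (x ⇒ y) ⊙ x ≡ x
    [x⇒y]⊙x≡x = trans (trans (div₁ x y) (div₂ x y))
                      (trans (cong (x ⊙_) x⇝y≡1) (⊙-identityʳ x))

  ⊙≤→≤⇝ : ∀ {x y z} → (x ⊙ y) ≤ z → y ≤ (x ⇝ z)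
  ⊙≤→≤⇝ {x} {y} {z} x⊙y≤z = ⇝≡1→≤ (trans (sym (⊙-⇝ x y z)) (≤→⇝≡1 x⊙y≤z))

  ≤⇝→⊙≤ : ∀ {x y z} → y ≤ (x ⇝ z) → (x ⊙ y) ≤ z
  ≤⇝→⊙≤ {x} {y} {z} y≤x⇝z = ⇝≡1→≤ (trans (⊙-⇝ x y z) (≤→⇝≡1 y≤x⇝z))

  ⇒-identityˡ : ∀ x → one ⇒ x ≡ x
  ⇒-identityˡ x = ≤-antisym (trans (sym (curry-one (one ⇒ x) x)) (⇒-refl _))
                            (trans (curry-one x x) (⇒-refl x))
    where
    curry-one : ∀ y z → y ⇒ (one ⇒ z) ≡ y ⇒ z
    curry-one y z = trans (sym (⊙-⇒ y one z)) (cong (_⇒ z) (⊙-identityʳ y))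

  ⇝-identityˡ : ∀ x → one ⇝ x ≡ x
  ⇝-identityˡ x = ≤-antisym 1⇝x≤x (⊙≤→≤⇝ 1⊙x≤x)
    where
    1⊙x≤x : (one ⊙ x) ≤ x
    1⊙x≤x = trans (cong (_⇒ x) (⊙-identityˡ x)) (⇒-refl x)
    1⇝x≤x : (one ⇝ x) ≤ x
    1⇝x≤x = trans (cong (_⇒ x) (sym (⊙-identityˡ _))) (≤⇝→⊙≤ (≤-refl (one ⇝ x)))

  ⇒-zeroʳ : ∀ x → x ⇒ one ≡ one
  ⇒-zeroʳ x = begin
    x ⇒ one                   ≡⟨ cong (_⇒ one) (sym [x⇒1]⊙x≡x) ⟩
    ((x ⇒ one) ⊙ x) ⇒ one     ≡⟨ ⊙-⇒ (x ⇒ one) x one ⟩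
    (x ⇒ one) ⇒ (x ⇒ one)     ≡⟨ ⇒-refl _ ⟩
    one                       ∎
    where
    [x⇒1]⊙x≡x : (x ⇒ one) ⊙ x ≡ x
    [x⇒1]⊙x≡x = trans (div₁ x one) (trans (⊙-identityʳ _) (⇒-identityˡ x))

  ≤-trans : ∀ {x y z} → x ≤ y → y ≤ z → x ≤ z
  ≤-trans {x} {y} {z} x≤y y≤z = begin
    x ⇒ z                   ≡⟨ cong (_⇒ z) (sym (≤→⊙-meet x≤y)) ⟩
    ((y ⇒ x) ⊙ y) ⇒ z       ≡⟨ ⊙-⇒ (y ⇒ x) y z ⟩
    (y ⇒ x) ⇒ (y ⇒ z)       ≡⟨ cong ((y ⇒ x) ⇒_) y≤z ⟩
    (y ⇒ x) ⇒ one           ≡⟨ ⇒-zeroʳ _ ⟩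
    one                     ∎

  x⊙y≤y : ∀ x y → (x ⊙ y) ≤ y
  x⊙y≤y x y = ≤⇒→⊙≤ (trans (cong (x ⇒_) (⇒-refl y)) (⇒-zeroʳ x))

  y≤x⇝y : ∀ x y → y ≤ (x ⇝ y)
  y≤x⇝y x y = ⊙≤→≤⇝ (x⊙y≤y x y)

  _∨_ : Carrier → Carrier → Carrier
  _∨_ = _∨₁_ A

  x≤x∨₁y : ∀ x y → x ≤ (x ∨ y)
  x≤x∨₁y x y = ⊙≤→≤⇝ (≤⇒→⊙≤ (≤-refl (x ⇒ y)))

  ∨₁-⇒ : ∀ x y → (x ∨ y) ⇒ y ≡ x ⇒ y
  ∨₁-⇒ x y = ≤-antisym (⊙≤→≤⇒ (≤⇝→⊙≤ (≤-trans (x≤x∨₁y x y) x∨y≤[x∨y⇒y]⇝y)))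
                       (⊙≤→≤⇒ (≤⇝→⊙≤ (≤-refl (x ∨ y))))
    where
    x∨y≤[x∨y⇒y]⇝y : (x ∨ y) ≤ (((x ∨ y) ⇒ y) ⇝ y)
    x∨y≤[x∨y⇒y]⇝y = ⊙≤→≤⇝ (≤⇒→⊙≤ (≤-refl ((x ∨ y) ⇒ y)))

  ∨₁-absorbˡ : ∀ x y → y ∨ (x ∨ y) ≡ x ∨ y
  ∨₁-absorbˡ x y =
    trans (cong (_⇝ (x ∨ y)) (y≤x⇝y (x ⇒ y) y)) (⇝-identityˡ (x ∨ y))

module _ (A : PseudoHoop) where
  open PseudoHoop A

  ≡→Θ : ∀ F → F one → ∀ {x y} → x ≡ y → Θ A F x y
  ≡→Θ F F1 {x} refl = F[x⇒x] , F[x⇒x]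
    where
    F[x⇒x] : F (x ⇒ x)
    F[x⇒x] = subst F (sym (⇒-refl x)) F1

  module Weaken {_≈₁_ _≈₂_ : Carrier → Carrier → Set}
                (≈₁⊆≈₂ : ∀ {x y} → x ≈₁ y → x ≈₂ y) where
    private
      module O₁ = Over A _≈₁_
      module O₂ = Over A _≈₂_

      both : ∀ {a b c d} → a ≈₁ b × c ≈₁ d → a ≈₂ b × c ≈₂ d
      both (a≈b , c≈d) = ≈₁⊆≈₂ a≈b , ≈₁⊆≈₂ c≈d

    IS1-weaken : ∀ {μ} → O₁.IS1 μ → O₂.IS1 μ
    IS1-weaken is1 x y = both (is1 x y)

    IS1'-weaken : ∀ {μ} → O₁.IS1' μ → O₂.IS1' μ
    IS1'-weaken is1' x y = both (is1' x y)

    IS2-weaken : ∀ {μ} → O₁.IS2 μ → O₂.IS2 μ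
    IS2-weaken is2 x y = both (is2 x y)

    IS3-weaken : ∀ {μ} → O₁.IS3 μ → O₂.IS3 μ
    IS3-weaken is3 x y = ≈₁⊆≈₂ (is3 x y)

    IS4-weaken : ∀ {μ} → O₁.IS4 μ → O₂.IS4 μ
    IS4-weaken is4 x y = both (is4 x y)

    TypeI-weaken : ∀ {μ} → O₁.TypeI μ → O₂.TypeI μ
    TypeI-weaken (is1 , is2 , is3 , is4) =
      IS1-weaken is1 , IS2-weaken is2 , IS3-weaken is3 , IS4-weaken is4

    TypeII-weaken : ∀ {μ} → O₁.TypeII μ → O₂.TypeII μ
    TypeII-weaken (is1' , is2 , is3 , is4) =
      IS1'-weaken is1' , IS2-weaken is2 , IS3-weaken is3 , IS4-weaken is4

module StateOperatorProperties (A : PseudoHoop)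
                               (μ : PseudoHoop.Carrier A → PseudoHoop.Carrier A) where
  open PseudoHoop A
  open PseudoHoopProperties A
  private module Dual = PseudoHoopProperties (dual A)
  open OnA A
  open ≡-Reasoning

  IS1'→IS1 : IS1' μ → IS1 μ
  IS1'→IS1 is1' x y = μ-⇒ , μ-⇝
    where
    μ-⇒ : μ (x ⇒ y) ≡ μ (x ∨ y) ⇒ μ y
    μ-⇒ = begin
      μ (x ⇒ y)                 ≡⟨ cong μ (sym (∨₁-⇒ x y)) ⟩
      μ ((x ∨ y) ⇒ y)           ≡⟨ proj₁ (is1' (x ∨ y) y) ⟩
      μ (y ∨ (x ∨ y)) ⇒ μ y     ≡⟨ cong (λ z → μ z ⇒ μ y) (∨₁-absorbˡ x y) ⟩
      μ (x ∨ y) ⇒ μ y           ∎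
    μ-⇝ : μ (x ⇝ y) ≡ μ (x Dual.∨ y) ⇝ μ y
    μ-⇝ = begin
      μ (x ⇝ y)                           ≡⟨ cong μ (sym (Dual.∨₁-⇒ x y)) ⟩
      μ ((x Dual.∨ y) ⇝ y)                ≡⟨ proj₂ (is1' (x Dual.∨ y) y) ⟩
      μ (y Dual.∨ (x Dual.∨ y)) ⇝ μ y     ≡⟨ cong (λ z → μ z ⇝ μ y) (Dual.∨₁-absorbˡ x y) ⟩
      μ (x Dual.∨ y) ⇝ μ y                ∎

  IS1→μ1≡1 : IS1 μ → μ one ≡ one
  IS1→μ1≡1 is1 = begin
    μ one                   ≡⟨ cong μ (sym (⇒-refl one)) ⟩
    μ (one ⇒ one)           ≡⟨ proj₁ (is1 one one) ⟩
    μ (one ∨ one) ⇒ μ one   ≡⟨ cong (λ z → μ z ⇒ μ one) 1∨1≡1 ⟩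
    μ one ⇒ μ one           ≡⟨ ⇒-refl (μ one) ⟩
    one                     ∎
    where
    1∨1≡1 : one ∨ one ≡ one
    1∨1≡1 = trans (cong (_⇝ one) (⇒-refl one)) (⇝-refl one)

  IS2→monotone : IS2 μ → ∀ {x y} → x ≤ y → μ x ≤ μ y
  IS2→monotone is2 {x} {y} x≤y = begin
    μ x ⇒ μ y                               ≡⟨ cong (λ z → μ z ⇒ μ y) (sym (≤→⊙-meet x≤y)) ⟩
    μ ((y ⇒ x) ⊙ y) ⇒ μ y                   ≡⟨ cong (_⇒ μ y) (proj₂ (is2 (y ⇒ x) y)) ⟩
    (μ (y ⇒ ((y ⇒ x) ⊙ y)) ⊙ μ y) ⇒ μ y     ≡⟨ x⊙y≤y _ _ ⟩
    one                                     ∎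

  idempotent : IS3 μ → μ one ≡ one → ∀ x → μ (μ x) ≡ μ x
  idempotent is3 μ1≡1 x = begin
    μ (μ x)             ≡⟨ cong μ (sym μx⊙μ1≡μx) ⟩
    μ (μ x ⊙ μ one)     ≡⟨ is3 x one ⟩
    μ x ⊙ μ one         ≡⟨ μx⊙μ1≡μx ⟩
    μ x                 ∎
    where
    μx⊙μ1≡μx : μ x ⊙ μ one ≡ μ x
    μx⊙μ1≡μx = trans (cong (μ x ⊙_) μ1≡1) (⊙-identityʳ (μ x))

  Ker-⇒→μ-≤ : IS1 μ → IS2 μ → ∀ {x y} → Ker μ (x ⇒ y) → μ x ≤ μ y
  Ker-⇒→μ-≤ is1 is2 {x} {y} μ[x⇒y]≡1 =
    ≤-trans (IS2→monotone is2 (x≤x∨₁y x y)) (trans (sym (proj₁ (is1 x y))) μ[x⇒y]≡1)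

  Ker-modusPonens : IS1 μ → IS2 μ → ∀ {x y} → Ker μ (x ⇒ y) → Ker μ x → Ker μ y
  Ker-modusPonens is1 is2 {x} {y} μ[x⇒y]≡1 μx≡1 = begin
    μ y           ≡⟨ sym (⇒-identityˡ (μ y)) ⟩
    one ⇒ μ y     ≡⟨ cong (_⇒ μ y) (sym μx≡1) ⟩
    μ x ⇒ μ y     ≡⟨ Ker-⇒→μ-≤ is1 is2 μ[x⇒y]≡1 ⟩
    one           ∎

module KernelQuotient (A : PseudoHoop)
                      (μ : PseudoHoop.Carrier A → PseudoHoop.Carrier A) where
  open PseudoHoop A
  open PseudoHoopProperties A
  open StateOperatorProperties A μ
  open OnA A
  private module A/K = OnQuot A (Ker μ)
  open ≡-Reasoning

  TypeI→RespectsMap/K : TypeI μ → A/K.RespectsMap μ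
  TypeI→RespectsMap/K (is1 , is2 , _ , is4) x y (x⇒y∈K , y⇒x∈K) =
    μ⇒μ∈K x⇒y∈K , μ⇒μ∈K y⇒x∈K
    where
    μ⇒μ∈K : ∀ {x y} → Ker μ (x ⇒ y) → Ker μ (μ x ⇒ μ y)
    μ⇒μ∈K {x} {y} x⇒y∈K = trans (proj₁ (is4 x y)) (Ker-⇒→μ-≤ is1 is2 x⇒y∈K)

  Ker/K→Ker : IS3 μ → μ one ≡ one → ∀ {x} → A/K.Ker μ x → Ker μ x
  Ker/K→Ker is3 μ1≡1 {x} (_ , 1⇒μx∈K) = begin
    μ x               ≡⟨ sym (idempotent is3 μ1≡1 x) ⟩
    μ (μ x)           ≡⟨ cong μ (sym (⇒-identityˡ (μ x))) ⟩
    μ (one ⇒ μ x)     ≡⟨ 1⇒μx∈K ⟩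
    one               ∎

  Ker→Ker/K : IS3 μ → μ one ≡ one → ∀ {x} → Ker μ x → A/K.Ker μ x
  Ker→Ker/K is3 μ1≡1 {x} μx≡1 =
    trans (cong μ (⇒-zeroʳ (μ x))) μ1≡1 ,
    trans (cong μ (⇒-identityˡ (μ x))) (trans (idempotent is3 μ1≡1 x) μx≡1)

  CompatibleTypeI→Compatible/K : CompatibleTypeI μ → A/K.Compatible μ
  CompatibleTypeI→Compatible/K ((is1 , is2 , is3 , _) , K-normal) = record
    { isFilter = record
      { respects  = λ x y (x⇒y∈K , _) x∈Ker/K →
          toKer/K (Ker-modusPonens is1 is2 x⇒y∈K (fromKer/K x∈Ker/K))
      ; nonempty  = one , toKer/K μ1≡1
      ; ⊙-closed  = λ x y x∈Ker/K y∈Ker/K →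
          toKer/K (KF.⊙-closed x y (fromKer/K x∈Ker/K) (fromKer/K y∈Ker/K))
      ; up-closed = λ x y x∈Ker/K (_ , 1⇒[x⇒y]∈K) →
          toKer/K (Ker-modusPonens is1 is2 (drop-1⇒ 1⇒[x⇒y]∈K) (fromKer/K x∈Ker/K))
      }
    ; normal₁ = λ x y x⇒y∈Ker/K → toKer/K (KN.normal₁ x y (fromKer/K x⇒y∈Ker/K))
    ; normal₂ = λ x y x⇝y∈Ker/K → toKer/K (KN.normal₂ x y (fromKer/K x⇝y∈Ker/K))
    }
    where
    module KN = IsNormalFilter K-normal
    module KF = IsFilter KN.isFilter
    μ1≡1 : μ one ≡ one
    μ1≡1 = IS1→μ1≡1 is1
    toKer/K : ∀ {x} → Ker μ x → A/K.Ker μ x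
    toKer/K = Ker→Ker/K is3 μ1≡1
    fromKer/K : ∀ {x} → A/K.Ker μ x → Ker μ x
    fromKer/K = Ker/K→Ker is3 μ1≡1
    drop-1⇒ : ∀ {x} → Ker μ (one ⇒ x) → Ker μ x
    drop-1⇒ {x} = trans (cong μ (sym (⇒-identityˡ x)))

theorem5p16 : (A : PseudoHoop) (μ : PseudoHoop.Carrier A → PseudoHoop.Carrier A) →
    OnA.CompatibleTypeII A μ →
    (OnQuot.RespectsMap A (OnA.Ker A μ) μ
      × OnQuot.CompatibleTypeI A (OnA.Ker A μ) μ
      × OnQuot.CompatibleTypeII A (OnA.Ker A μ) μ)
    × OnA.CompatibleTypeI A μ
theorem5p16 A μ (typeII@(is1' , is2 , is3 , is4) , K-normal) =
  ( TypeI→RespectsMap/K typeI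
  , (TypeI-weaken typeI , compatible/K)
  , (TypeII-weaken typeII , compatible/K) )
  , (typeI , K-normal)
  where
  open StateOperatorProperties A μ
  open KernelQuotient A μ
  is1 : OnA.IS1 A μ
  is1 = IS1'→IS1 is1'
  typeI : OnA.TypeI A μ
  typeI = is1 , is2 , is3 , is4
  open Weaken A {_≡_} {Θ A (OnA.Ker A μ)} (≡→Θ A (OnA.Ker A μ) (IS1→μ1≡1 is1))
  compatible/K : OnQuot.Compatible A (OnA.Ker A μ) μ
  compatible/K = CompatibleTypeI→Compatible/K (typeI , K-normal)
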